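{- For every finite simple graph $\Gamma$ with adjacency matrix $A(\Gamma)$, $\mathrm{rank}(I+A(\Gamma))\le |V(S\Omega(\Gamma))|$.
   Context: For a graph $\Gamma$, consider partitions of $V(\Gamma)$ into nonempty parts such that each part induces a complete subgraph and, for any two distinct parts $P,Q$, either every vertex of $P$ is adjacent to every vertex of $Q$ or no vertex of $P$ is adjacent to any vertex of $Q$. The complete skeleton $\Omega(\Gamma)$ is such a partition with the minimum number of parts; its structure $S\Omega(\Gamma)$ is the simple graph whose vertices are the parts, two parts being adjacent iff they are completely joined. Rank is over the reals. -}

module Defs where

open import Data.Nat using (ℕ; zero; suc; _≤_)
open import Data.Fin using (Fin; zero; suc; _≟_)
open import Data.Bool using (Bool; true; false; if_then_else_)
open import Data.Rational using (ℚ; 0ℚ; 1ℚ; _+_; _*_)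
open import Data.Product using (Σ; _×_; ∃)
open import Relation.Nullary using (¬_; yes; no)
open import Relation.Binary.PropositionalEquality using (_≡_; _≢_)
open import Function.Definitions using (Surjective; Injective)

record SimpleGraph (n : ℕ) : Set where
  field
    Adj   : Fin n → Fin n → Bool
    sym   : ∀ u v → Adj u v ≡ Adj v u
    loopless : ∀ v → Adj v v ≡ false
open SimpleGraph public

record CliquePartition {n : ℕ} (Γ : SimpleGraph n) (k : ℕ) : Set where
  field
    part      : Fin n → Fin k
    nonempty  : Surjective _≡_ _≡_ part
    clique    : ∀ u v → u ≢ v → part u ≡ part v → Adj Γ u v ≡ true
    homogeneous : ∀ u u' v v' → part u ≡ part u' → part v ≡ part v' →
                  part u ≢ part v → Adj Γ u v ≡ Adj Γ u' v'

-- k is the number of parts of the complete skeleton Ω(Γ), i.e. |V(SΩ(Γ))|: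
-- the minimum number of parts of such a partition.
IsSkeletonSize : {n : ℕ} → SimpleGraph n → ℕ → Set
IsSkeletonSize Γ k = CliquePartition Γ k × (∀ m → CliquePartition Γ m → k ≤ m)

∑ : (m : ℕ) → (Fin m → ℚ) → ℚ
∑ zero f = 0ℚ
∑ (suc m) f = f zero + ∑ m (λ i → f (suc i))

Matrix : ℕ → ℕ → Set
Matrix r c = Fin r → Fin c → ℚ

adjMatrix : {n : ℕ} → SimpleGraph n → Matrix n n
adjMatrix Γ i j = if Adj Γ i j then 1ℚ else 0ℚ

idMatrix : (n : ℕ) → Matrix n n
idMatrix n i j with i ≟ j
... | yes _ = 1ℚ
... | no _  = 0ℚ

_+ᴹ_ : {r c : ℕ} → Matrix r c → Matrix r c → Matrix r c
(M +ᴹ N) i j = M i j + N i j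

LinIndep : {m c : ℕ} → (Fin m → Fin c → ℚ) → Set
LinIndep {m} {c} v = ∀ (a : Fin m → ℚ) → (∀ j → ∑ m (λ i → a i * v i j) ≡ 0ℚ) → ∀ i → a i ≡ 0ℚ

Rank : {r c : ℕ} → Matrix r c → ℕ → Set
Rank {r} M k =
  (Σ (Fin k → Fin r) λ σ → Injective _≡_ _≡_ σ × LinIndep (λ i → M (σ i)))
  × (∀ m (σ : Fin m → Fin r) → Injective _≡_ _≡_ σ → LinIndep (λ i → M (σ i)) → m ≤ k)

-- Vertices in the same part of a clique partition have the same closed neighbourhood,
-- so they index equal rows of I + A(Γ). Linearly independent rows are pairwise distinct,
-- hence an independent family of r rows lands in r different parts: r ≤ k.
module Submission where

open import Defs hiding (sym)
open import Data.Bool using (if_then_else_)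
open import Data.Nat using (ℕ; _≤_) renaming (zero to nzero; suc to nsuc)
open import Data.Fin using (Fin; zero; suc; _≟_)
open import Data.Fin.Properties using (injective⇒≤; suc-injective)
open import Data.Rational using (ℚ; 0ℚ; 1ℚ; _+_; _*_; -_)
import Data.Rational.Properties as ℚ
open import Data.Empty using (⊥-elim)
open import Data.Product using (_,_)
open import Function using (_∘_)
open import Relation.Nullary using (Dec; yes; no)
open import Relation.Binary.PropositionalEquality
open import Algebra.Bundles using (CommutativeMonoid)
open import Algebra.Properties.CommutativeSemigroup
  (CommutativeMonoid.commutativeSemigroup ℚ.+-0-commutativeMonoid) using (interchange)

idMatrix-diag : ∀ n (i : Fin n) → idMatrix n i i ≡ 1ℚ
idMatrix-diag n i with i ≟ i
... | yes _ = refl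
... | no i≢i = ⊥-elim (i≢i refl)

idMatrix-offDiag : ∀ n {i j : Fin n} → i ≢ j → idMatrix n i j ≡ 0ℚ
idMatrix-offDiag n {i} {j} i≢j with i ≟ j
... | yes i≡j = ⊥-elim (i≢j i≡j)
... | no _ = refl

∑-cong : ∀ m {f g : Fin m → ℚ} → (∀ x → f x ≡ g x) → ∑ m f ≡ ∑ m g
∑-cong nzero f≗g = refl
∑-cong (nsuc m) f≗g = cong₂ _+_ (f≗g zero) (∑-cong m (λ x → f≗g (suc x)))

∑-distrib-+ : ∀ m (f g : Fin m → ℚ) → ∑ m (λ x → f x + g x) ≡ ∑ m f + ∑ m g
∑-distrib-+ nzero f g = refl
∑-distrib-+ (nsuc m) f g
  rewrite ∑-distrib-+ m (λ x → f (suc x)) (λ x → g (suc x)) = interchange (f zero) (g zero) _ _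

∑-zero : ∀ m {f : Fin m → ℚ} → (∀ x → f x ≡ 0ℚ) → ∑ m f ≡ 0ℚ
∑-zero nzero f≗0 = refl
∑-zero (nsuc m) f≗0 rewrite f≗0 zero | ∑-zero m (λ x → f≗0 (suc x)) = refl

∑-supported : ∀ m (i : Fin m) {f : Fin m → ℚ} → (∀ x → x ≢ i → f x ≡ 0ℚ) → ∑ m f ≡ f i
∑-supported (nsuc m) zero {f} vanish
  rewrite ∑-zero m (λ x → vanish (suc x) λ ()) = ℚ.+-identityʳ (f zero)
∑-supported (nsuc m) (suc i) {f} vanish
  rewrite vanish zero (λ ()) | ∑-supported m i (λ x x≢i → vanish (suc x) (x≢i ∘ suc-injective))
  = ℚ.+-identityˡ (f (suc i))

∑-idMatrix : ∀ m (i : Fin m) (F : Fin m → ℚ) → ∑ m (λ x → idMatrix m i x * F x) ≡ F i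
∑-idMatrix m i F = begin
  ∑ m (λ x → idMatrix m i x * F x) ≡⟨ ∑-supported m i vanish ⟩
  idMatrix m i i * F i             ≡⟨ cong (_* F i) (idMatrix-diag m i) ⟩
  1ℚ * F i                         ≡⟨ ℚ.*-identityˡ (F i) ⟩
  F i                              ∎
  where
  open ≡-Reasoning
  vanish : ∀ x → x ≢ i → idMatrix m i x * F x ≡ 0ℚ
  vanish x x≢i = trans (cong (_* F x) (idMatrix-offDiag m (x≢i ∘ sym))) (ℚ.*-zeroˡ (F x))

linIndep-injective : ∀ {m c} (v : Fin m → Fin c → ℚ) → LinIndep v →
                     ∀ {x y} → (∀ j → v x j ≡ v y j) → x ≡ y
linIndep-injective {m} v independent {x} {y} vx≗vy with x ≟ y
... | yes x≡y = x≡y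
... | no x≢y = ⊥-elim (ℚ.1≢0 (trans (sym coefficient-x) (independent a relation x)))
  where
  open ≡-Reasoning
  a : Fin m → ℚ
  a z = idMatrix m x z + - idMatrix m y z

  coefficient-x : a x ≡ 1ℚ
  coefficient-x rewrite idMatrix-diag m x | idMatrix-offDiag m (x≢y ∘ sym) = refl

  split : ∀ p q w → (p + - q) * w ≡ p * w + q * - w
  split p q w = begin
    (p + - q) * w      ≡⟨ ℚ.*-distribʳ-+ w p (- q) ⟩
    p * w + - q * w    ≡⟨ cong (p * w +_) (sym (ℚ.neg-distribˡ-* q w)) ⟩
    p * w + - (q * w)  ≡⟨ cong (p * w +_) (ℚ.neg-distribʳ-* q w) ⟩
    p * w + q * - w    ∎

  relation : ∀ j → ∑ m (λ i → a i * v i j) ≡ 0ℚ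
  relation j = begin
    ∑ m (λ i → a i * v i j)
      ≡⟨ ∑-cong m (λ i → split (idMatrix m x i) (idMatrix m y i) (v i j)) ⟩
    ∑ m (λ i → idMatrix m x i * v i j + idMatrix m y i * - v i j)
      ≡⟨ ∑-distrib-+ m _ _ ⟩
    ∑ m (λ i → idMatrix m x i * v i j) + ∑ m (λ i → idMatrix m y i * - v i j)
      ≡⟨ cong₂ _+_ (∑-idMatrix m x (λ i → v i j)) (∑-idMatrix m y (λ i → - v i j)) ⟩
    v x j + - v y j
      ≡⟨ cong (_+ - v y j) (vx≗vy j) ⟩
    v y j + - v y j
      ≡⟨ ℚ.+-inverseʳ (v y j) ⟩
    0ℚ ∎

module _ {n : ℕ} (Γ : SimpleGraph n) where

  closedAdj : Matrix n n
  closedAdj = idMatrix n +ᴹ adjMatrix Γ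

  closedAdj-diag : ∀ w → closedAdj w w ≡ 1ℚ
  closedAdj-diag w rewrite idMatrix-diag n w | loopless Γ w = refl

  closedAdj-offDiag : ∀ {u w} → u ≢ w → closedAdj u w ≡ adjMatrix Γ u w
  closedAdj-offDiag {u} {w} u≢w rewrite idMatrix-offDiag n u≢w = ℚ.+-identityˡ _

  module _ {k : ℕ} (P : CliquePartition Γ k) where
    open CliquePartition P

    closedAdj-samePart : ∀ {u w} → u ≢ w → part u ≡ part w → closedAdj u w ≡ 1ℚ
    closedAdj-samePart {u} {w} u≢w same
      rewrite closedAdj-offDiag u≢w | clique u w u≢w same = refl

    samePart⇒sameAdj : ∀ {u v w} → part u ≡ part v → u ≢ w → v ≢ w → Adj Γ u w ≡ Adj Γ v w
    samePart⇒sameAdj {u} {v} {w} same u≢w v≢w with part u ≟ part w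
    ... | yes uw = trans (clique u w u≢w uw) (sym (clique v w v≢w (trans (sym same) uw)))
    ... | no ¬uw = homogeneous u v w w same refl ¬uw

    samePart⇒sameRow : ∀ {u v} → part u ≡ part v → ∀ w → closedAdj u w ≡ closedAdj v w
    samePart⇒sameRow {u} {v} same w with u ≟ v
    ... | yes refl = refl
    ... | no u≢v = byCases (u ≟ w) (v ≟ w)
      where
      open ≡-Reasoning
      -- Taking the decisions as arguments, not via `with`, keeps the `≟` inside idMatrix unabstracted.
      byCases : Dec (u ≡ w) → Dec (v ≡ w) → closedAdj u w ≡ closedAdj v w
      byCases (yes refl) _ = trans (closedAdj-diag u) (sym (closedAdj-samePart (u≢v ∘ sym) (sym same)))
      byCases (no _) (yes refl) = trans (closedAdj-samePart u≢v same) (sym (closedAdj-diag v))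
      byCases (no u≢w) (no v≢w) = begin
        closedAdj u w     ≡⟨ closedAdj-offDiag u≢w ⟩
        adjMatrix Γ u w   ≡⟨ cong (λ b → if b then 1ℚ else 0ℚ) (samePart⇒sameAdj same u≢w v≢w) ⟩
        adjMatrix Γ v w   ≡⟨ sym (closedAdj-offDiag v≢w) ⟩
        closedAdj v w     ∎

    rank≤parts : ∀ {r} → Rank closedAdj r → r ≤ k
    rank≤parts ((σ , _ , independent) , _) = injective⇒≤ {f = part ∘ σ} λ same →
      linIndep-injective (closedAdj ∘ σ) independent (samePart⇒sameRow same)

theorem4p5 : ∀ (n : ℕ) (Γ : SimpleGraph n) (k r : ℕ) →
    IsSkeletonSize Γ k → Rank (idMatrix n +ᴹ adjMatrix Γ) r → r ≤ k
theorem4p5 n Γ k r (skeleton , _) = rank≤parts Γ skeleton
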